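{- For every $n\ge1$, every $2$-colouring of the edges of $Q_n$ contains a monochromatic geodesic of length $\lceil n/2\rceil$.
   Context: The hypercube $Q_n$ has vertex set $\{0,1\}^n$, two vertices being adjacent if they differ in exactly one coordinate; the direction of an edge is that coordinate. A path is a geodesic if no two of its edges have the same direction; its length is its number of edges. -}

module Defs where

open import Data.Bool using (Bool; not)
open import Data.Nat using (ℕ; suc; _+_; _/_)
open import Data.Fin using (Fin)
open import Data.Vec using (Vec; updateAt)
open import Data.List using (List; []; _∷_; length)
open import Data.List.Relation.Unary.Unique.Propositional using (Unique)
open import Data.Unit using (⊤)
open import Data.Product using (_×_)
open import Relation.Binary.PropositionalEquality using (_≡_)

-- Vertices of Q_n: Vec Bool n.  Flipping coordinate i gives the neighbour
-- across the edge of direction i.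
Vertex : ℕ → Set
Vertex n = Vec Bool n

flip : ∀ {n} → Fin n → Vertex n → Vertex n
flip i v = updateAt v i not

-- An edge of Q_n is an unordered pair {v , flip i v}; it is named by either
-- endpoint together with its direction i.
IsEdgeColouring : ∀ {n} → (Vertex n → Fin n → Bool) → Set
IsEdgeColouring {n} c = ∀ (v : Vertex n) (i : Fin n) → c v i ≡ c (flip i v) i

-- A path in Q_n starting at v is given by the list of directions of its
-- successive edges: v₀ = v, v_{k+1} = flip d_k v_k.
-- All edges of the path starting at v with directions ds have colour b.
AllColoured : ∀ {n} → (Vertex n → Fin n → Bool) → Bool → Vertex n → List (Fin n) → Set
AllColoured c b v [] = ⊤
AllColoured c b v (d ∷ ds) = (c v d ≡ b) × AllColoured c b (flip d v) ds

IsGeodesic : ∀ {n} → List (Fin n) → Set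
IsGeodesic ds = Unique ds

ceilHalf : ℕ → ℕ
ceilHalf m = (m + 1) / 2

-- From a vertex v, the b-greedy path runs through the directions in order and
-- crosses the edge of direction i whenever that edge has colour b; it is a
-- monochromatic geodesic.  An edge of direction 0 has one colour, so for that
-- colour the greedy paths at both of its endpoints start with it.  Hence, by
-- induction on the dimension, the lengths of the two greedy paths (one per
-- colour) summed over all vertices of Q_n are at least n·2^n.  Some vertex
-- therefore carries greedy paths of total length at least n, and one of them
-- has length at least ⌈n/2⌉; a prefix of it is the required geodesic.
module Submission where

open import Defs
open import Data.Bool using (Bool; true; false; not)
open import Data.Bool.Properties using (_≟_; not-¬)
open import Data.Nat using (ℕ; zero; suc; _+_; _*_; _^_; _≤_; _≥_; z≤n; s≤s)
open import Data.Nat.Properties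
  using (≤-trans; <⇒≱; ≰⇒>; m≤n⇒m≤1+n; m≤n⇒m⊓n≡m; +-suc; +-comm; *-identityʳ; +-mono-≤; +-monoʳ-≤; _≤?_; module ≤-Reasoning)
open import Data.Nat.DivMod using (m/n*n≤m)
open import Data.Nat.Tactic.RingSolver using (solve-∀)
open import Data.Fin using (Fin)
import Data.Fin as Fin
import Data.Fin.Properties as Fin
open import Data.Vec using ([]; _∷_)
open import Data.List using (List; []; _∷_; length; map; take)
open import Data.List.Properties using (length-map; length-take)
import Data.List.Relation.Unary.All as All
import Data.List.Relation.Unary.All.Properties as All
open import Data.List.Relation.Unary.AllPairs using ([]; _∷_)
import Data.List.Relation.Unary.Unique.Propositional.Properties as Unique
open import Data.Product using (Σ; ∃-syntax; _×_; _,_)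
open import Data.Sum using (_⊎_; inj₁; inj₂)
open import Data.Unit using (tt)
open import Relation.Nullary using (yes; no; contradiction)
open import Relation.Binary.PropositionalEquality using (_≡_; refl; sym; trans; cong; cong₂; subst; subst₂)

Colouring : ℕ → Set
Colouring n = Vertex n → Fin n → Bool

MonochromaticGeodesic : ∀ {n} → Colouring n → Bool → Vertex n → ℕ → Set
MonochromaticGeodesic {n} c b v k =
  Σ (List (Fin n)) λ ds → IsGeodesic ds × AllColoured c b v ds × length ds ≡ k

face : ∀ {n} → Colouring (suc n) → Bool → Colouring n
face c x v i = c (x ∷ v) (Fin.suc i)

face-isEdgeColouring : ∀ {n} {c : Colouring (suc n)} →
  IsEdgeColouring c → ∀ x → IsEdgeColouring (face c x)
face-isEdgeColouring ec x v i = ec (x ∷ v) (Fin.suc i)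

allColoured-map-suc : ∀ {n} {c : Colouring (suc n)} {b x} v ds →
  AllColoured (face c x) b v ds → AllColoured c b (x ∷ v) (map Fin.suc ds)
allColoured-map-suc v []       tt       = tt
allColoured-map-suc v (d ∷ ds) (e , es) = e , allColoured-map-suc (flip d v) ds es

allColoured-take : ∀ {n} {c : Colouring n} {b} k v ds →
  AllColoured c b v ds → AllColoured c b v (take k ds)
allColoured-take zero    v ds       _        = tt
allColoured-take (suc k) v []       _        = tt
allColoured-take (suc k) v (d ∷ ds) (e , es) = e , allColoured-take k (flip d v) ds es

greedy : ∀ {n} → Colouring n → Bool → Vertex n → List (Fin n)
greedy c b []      = []
greedy c b (x ∷ v) with c (x ∷ v) Fin.zero ≟ b
... | yes _ = Fin.zero ∷ map Fin.suc (greedy (face c (not x)) b v)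
... | no _  = map Fin.suc (greedy (face c x) b v)

greedy-isGeodesic : ∀ {n} (c : Colouring n) b v → IsGeodesic (greedy c b v)
greedy-isGeodesic c b []      = []
greedy-isGeodesic c b (x ∷ v) with c (x ∷ v) Fin.zero ≟ b
... | yes _ = All.map⁺ (All.universal (λ _ ()) _)
            ∷ Unique.map⁺ Fin.suc-injective (greedy-isGeodesic (face c (not x)) b v)
... | no _  = Unique.map⁺ Fin.suc-injective (greedy-isGeodesic (face c x) b v)

greedy-allColoured : ∀ {n} (c : Colouring n) b v → AllColoured c b v (greedy c b v)
greedy-allColoured c b []      = tt
greedy-allColoured c b (x ∷ v) with c (x ∷ v) Fin.zero ≟ b
... | yes e = e , allColoured-map-suc v _ (greedy-allColoured (face c (not x)) b v)
... | no _  = allColoured-map-suc v _ (greedy-allColoured (face c x) b v)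

length-greedy-taken : ∀ {n} (c : Colouring (suc n)) {b} x v → c (x ∷ v) Fin.zero ≡ b →
  length (greedy c b (x ∷ v)) ≡ suc (length (greedy (face c (not x)) b v))
length-greedy-taken c {b} x v e with c (x ∷ v) Fin.zero ≟ b
... | yes _ = cong suc (length-map Fin.suc (greedy (face c (not x)) b v))
... | no ¬e = contradiction e ¬e

length-greedy-skipped : ∀ {n} (c : Colouring (suc n)) {b} x v → c (x ∷ v) Fin.zero ≡ not b →
  length (greedy c b (x ∷ v)) ≡ length (greedy (face c x) b v)
length-greedy-skipped c {b} x v e with c (x ∷ v) Fin.zero ≟ b
... | yes e′ = contradiction e (not-¬ e′)
... | no _   = length-map Fin.suc (greedy (face c x) b v)

greedy-prefix : ∀ {n} (c : Colouring n) b v {k} →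
  k ≤ length (greedy c b v) → MonochromaticGeodesic c b v k
greedy-prefix c b v {k} k≤ =
  take k ds , Unique.take⁺ k (greedy-isGeodesic c b v) ,
  allColoured-take k v ds (greedy-allColoured c b v) ,
  trans (length-take k ds) (m≤n⇒m⊓n≡m k≤)
  where ds = greedy c b v

greedyTotal : ∀ {n} → Colouring n → Vertex n → ℕ
greedyTotal c v = length (greedy c true v) + length (greedy c false v)

greedyTotal-edge : ∀ {n} (c : Colouring (suc n)) → IsEdgeColouring c → ∀ x →
  greedyTotal c (false ∷ x) + greedyTotal c (true ∷ x)
    ≡ 2 + (greedyTotal (face c false) x + greedyTotal (face c true) x)
greedyTotal-edge c ec x = by-edge-colour (c (false ∷ x) Fin.zero) refl
  where
  ℓ : Bool → Bool → ℕ
  ℓ y b = length (greedy (face c y) b x)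

  arrange : ∀ a b c d → (suc a + b) + (suc c + d) ≡ 2 + ((c + b) + (a + d))
  arrange = solve-∀

  arrange′ : ∀ a b c d → (a + suc b) + (c + suc d) ≡ 2 + ((a + d) + (c + b))
  arrange′ = solve-∀

  by-edge-colour : ∀ e → c (false ∷ x) Fin.zero ≡ e →
    greedyTotal c (false ∷ x) + greedyTotal c (true ∷ x)
      ≡ 2 + (greedyTotal (face c false) x + greedyTotal (face c true) x)
  by-edge-colour true e = trans
    (cong₂ _+_ (cong₂ _+_ (length-greedy-taken c false x e) (length-greedy-skipped c false x e))
               (cong₂ _+_ (length-greedy-taken c true x e′) (length-greedy-skipped c true x e′)))
    (arrange (ℓ true true) (ℓ false false) (ℓ false true) (ℓ true false))
    where e′ = trans (sym (ec (false ∷ x) Fin.zero)) e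
  by-edge-colour false e = trans
    (cong₂ _+_ (cong₂ _+_ (length-greedy-skipped c false x e) (length-greedy-taken c false x e))
               (cong₂ _+_ (length-greedy-skipped c true x e′) (length-greedy-taken c true x e′)))
    (arrange′ (ℓ false true) (ℓ true false) (ℓ true true) (ℓ false false))
    where e′ = trans (sym (ec (false ∷ x) Fin.zero)) e

∑ : ∀ n → (Vertex n → ℕ) → ℕ
∑ zero    f = f []
∑ (suc n) f = ∑ n (λ x → f (false ∷ x) + f (true ∷ x))

∑-cong : ∀ n {f g : Vertex n → ℕ} → (∀ v → f v ≡ g v) → ∑ n f ≡ ∑ n g
∑-cong zero    f≗g = f≗g []
∑-cong (suc n) f≗g = ∑-cong n (λ x → cong₂ _+_ (f≗g (false ∷ x)) (f≗g (true ∷ x)))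

∑-+ : ∀ n (f g : Vertex n → ℕ) → ∑ n (λ v → f v + g v) ≡ ∑ n f + ∑ n g
∑-+ zero    f g = refl
∑-+ (suc n) f g = trans (∑-cong n (λ x → interchange (f (false ∷ x)) (g (false ∷ x)) (f (true ∷ x)) (g (true ∷ x))))
                        (∑-+ n (λ x → f (false ∷ x) + f (true ∷ x)) (λ x → g (false ∷ x) + g (true ∷ x)))
  where
  interchange : ∀ a b c d → (a + b) + (c + d) ≡ (a + c) + (b + d)
  interchange = solve-∀

∑-const : ∀ n k → ∑ n (λ _ → k) ≡ k * 2 ^ n
∑-const zero    k = sym (*-identityʳ k)
∑-const (suc n) k = trans (∑-const n (k + k)) (double k (2 ^ n))
  where
  double : ∀ k p → (k + k) * p ≡ k * (2 * p)
  double = solve-∀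

≤-⊎-≤-of-double : ∀ m a b → m + m ≤ suc (a + b) → m ≤ a ⊎ m ≤ b
≤-⊎-≤-of-double m a b h with m ≤? a | m ≤? b
... | yes m≤a | _       = inj₁ m≤a
... | no _    | yes m≤b = inj₂ m≤b
... | no m≰a  | no m≰b  = contradiction h (<⇒≱ a+b+2≤m+m)
  where
  a+b+2≤m+m : suc (suc (a + b)) ≤ m + m
  a+b+2≤m+m = subst (_≤ m + m) (cong suc (+-suc a b)) (+-mono-≤ (≰⇒> m≰a) (≰⇒> m≰b))

∑-average : ∀ n (f : Vertex n → ℕ) m → m * 2 ^ n ≤ ∑ n f → ∃[ v ] m ≤ f v
∑-average zero    f m h = [] , subst (_≤ f []) (*-identityʳ m) h
∑-average (suc n) f m h = choose (∑-average n pairSum (m + m) (subst (_≤ ∑ n pairSum) (regroup m (2 ^ n)) h))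
  where
  pairSum : Vertex n → ℕ
  pairSum x = f (false ∷ x) + f (true ∷ x)
  regroup : ∀ m p → m * (2 * p) ≡ (m + m) * p
  regroup = solve-∀
  choose : ∃[ x ] m + m ≤ pairSum x → ∃[ v ] m ≤ f v
  choose (x , m+m≤) with ≤-⊎-≤-of-double m (f (false ∷ x)) (f (true ∷ x)) (m≤n⇒m≤1+n m+m≤)
  ... | inj₁ m≤ = false ∷ x , m≤
  ... | inj₂ m≤ = true ∷ x , m≤

greedyTotal-∑-bound : ∀ n (c : Colouring n) → IsEdgeColouring c → n * 2 ^ n ≤ ∑ n (greedyTotal c)
greedyTotal-∑-bound zero    c ec = z≤n
greedyTotal-∑-bound (suc n) c ec = begin
  suc n * 2 ^ suc n                                ≡⟨ expand n (2 ^ n) ⟩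
  2 * 2 ^ n + (n * 2 ^ n + n * 2 ^ n)              ≤⟨ +-monoʳ-≤ (2 * 2 ^ n) (+-mono-≤ (bound false) (bound true)) ⟩
  2 * 2 ^ n + (∑ n (T false) + ∑ n (T true))       ≡⟨ sym (cong₂ _+_ (∑-const n 2) (∑-+ n (T false) (T true))) ⟩
  ∑ n (λ _ → 2) + ∑ n (λ x → T false x + T true x) ≡⟨ sym (∑-+ n (λ _ → 2) (λ x → T false x + T true x)) ⟩
  ∑ n (λ x → 2 + (T false x + T true x))           ≡⟨ sym (∑-cong n (greedyTotal-edge c ec)) ⟩
  ∑ (suc n) (greedyTotal c)                        ∎
  where
  open ≤-Reasoning
  T : Bool → Vertex n → ℕ
  T y = greedyTotal (face c y)
  bound : ∀ y → n * 2 ^ n ≤ ∑ n (T y)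
  bound y = greedyTotal-∑-bound n (face c y) (face-isEdgeColouring ec y)
  expand : ∀ n p → suc n * (2 * p) ≡ 2 * p + (n * p + n * p)
  expand = solve-∀

ceilHalf-double : ∀ n → ceilHalf n + ceilHalf n ≤ suc n
ceilHalf-double n = subst₂ _≤_ (twice (ceilHalf n)) (+-comm n 1) (m/n*n≤m (n + 1) 2)
  where
  twice : ∀ h → h * 2 ≡ h + h
  twice = solve-∀

corollary1 : (n : ℕ) → n ≥ 1 →
    (c : Vertex n → Fin n → Bool) → IsEdgeColouring c →
    Σ Bool λ b → Σ (Vertex n) λ v → Σ (List (Fin n)) λ ds →
      IsGeodesic ds × AllColoured c b v ds × length ds ≡ ceilHalf n
corollary1 n _ c ec with ∑-average n (greedyTotal c) n (greedyTotal-∑-bound n c ec)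
... | v , n≤total
  with ≤-⊎-≤-of-double (ceilHalf n) _ _ (≤-trans (ceilHalf-double n) (s≤s n≤total))
...   | inj₁ short≤true  = true  , v , greedy-prefix c true  v short≤true
...   | inj₂ short≤false = false , v , greedy-prefix c false v short≤false
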